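{- Let $n\ge1$. The orbits of the action $P\cdot M=\overline{\overline{P}M}$ of $H_n$ on $\mathcal{C}(G_n)$ partition $\mathcal{C}(G_n)$ into subsets each of cardinality $|H_n|=2^n\cdot n!$; consequently the number of orbits is $|\mathcal{C}(G_n)|/(2^n\cdot n!)$.
   Context: Let $Q_n=\{1,\dots,n\}$. A preference matrix on $Q_n$ is a $2^n\times n$ $0/1$ matrix whose rows are exactly the $2^n$ elements of $\{0,1\}^n$, each once. $\mathcal{C}(G_n)$ is the set of preference matrices on $Q_n$ in which consecutive rows differ in exactly one coordinate. $H_n$ is the group of $n\times n$ matrices with entries in $\{0,\pm1\}$ having exactly one nonzero entry in each row and column. For a matrix with entries in $\{0,\pm1\}$, $\overline{P}$ replaces each $0$ by $-1$ and each $-1$ by $0$; $P\cdot M=\overline{\overline{P}M}$ is a right action of $H_n$ on $\mathcal{C}(G_n)$. -}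

module Defs where

open import Data.Nat using (ℕ; zero; suc; _^_)
open import Data.Integer using (ℤ; _+_; _*_; -_; 0ℤ; 1ℤ; -1ℤ; +_; -[1+_])
open import Data.Fin using (Fin; toℕ)
open import Data.Vec using (Vec; lookup; tabulate; map; foldr)
open import Data.Product using (Σ; ∃; _×_; _,_)
open import Data.Sum using (_⊎_)
open import Data.List using (List)
open import Data.List.Membership.Propositional using (_∈_)
open import Relation.Binary.PropositionalEquality using (_≡_; _≢_)

Matrix : ℕ → ℕ → Set
Matrix m n = Vec (Vec ℤ n) m

entry : ∀ {m n} → Matrix m n → Fin m → Fin n → ℤ
entry M i j = lookup (lookup M i) j

row : ∀ {m n} → Matrix m n → Fin m → Vec ℤ n
row M i = lookup M i

sumℤ : ∀ {k} → Vec ℤ k → ℤ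
sumℤ = foldr _ _+_ 0ℤ

_⊗_ : ∀ {m k n} → Matrix m k → Matrix k n → Matrix m n
A ⊗ B = tabulate λ i → tabulate λ j → sumℤ (tabulate λ l → entry A i l * entry B l j)

bar : ℤ → ℤ
bar (+ zero) = -1ℤ
bar -[1+ zero ] = 0ℤ
bar x = x

barM : ∀ {m n} → Matrix m n → Matrix m n
barM M = map (map bar) M

IsBit : ℤ → Set
IsBit x = (x ≡ 0ℤ) ⊎ (x ≡ 1ℤ)

IsBinary : ∀ {n} → Vec ℤ n → Set
IsBinary v = ∀ k → IsBit (lookup v k)

IsPreferenceMatrix : ∀ n → Matrix (2 ^ n) n → Set
IsPreferenceMatrix n M =
  (∀ i j → IsBit (entry M i j)) ×
  (∀ (v : Vec ℤ n) → IsBinary v →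
     Σ (Fin (2 ^ n)) λ i → (row M i ≡ v) × (∀ i′ → row M i′ ≡ v → i′ ≡ i))

DifferInExactlyOne : ∀ {n} → Vec ℤ n → Vec ℤ n → Set
DifferInExactlyOne {n} u v =
  Σ (Fin n) λ k → (lookup u k ≢ lookup v k) ×
    (∀ l → lookup u l ≢ lookup v l → l ≡ k)

InC : ∀ n → Matrix (2 ^ n) n → Set
InC n M = IsPreferenceMatrix n M ×
  (∀ (i j : Fin (2 ^ n)) → toℕ j ≡ suc (toℕ i) → DifferInExactlyOne (row M i) (row M j))

InH : ∀ n → Matrix n n → Set
InH n P =
  (∀ i j → (entry P i j ≡ 0ℤ) ⊎ (entry P i j ≡ 1ℤ) ⊎ (entry P i j ≡ -1ℤ)) ×
  (∀ i → Σ (Fin n) λ j → (entry P i j ≢ 0ℤ) × (∀ j′ → entry P i j′ ≢ 0ℤ → j′ ≡ j)) ×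
  (∀ j → Σ (Fin n) λ i → (entry P i j ≢ 0ℤ) × (∀ i′ → entry P i′ j ≢ 0ℤ → i′ ≡ i))

act : ∀ {n} → Matrix n n → Matrix (2 ^ n) n → Matrix (2 ^ n) n
act P M = barM (barM M ⊗ P)

InOrbit : ∀ n → Matrix (2 ^ n) n → Matrix (2 ^ n) n → Set
InOrbit n M N = Σ (Matrix n n) λ P → InH n P × (act P M ≡ N)

-- L is a duplicate-free enumeration of the predicate S (so length L = |S|)
open import Data.List.Relation.Unary.Unique.Propositional using (Unique)
open import Function.Bundles using (_⇔_)

Enumerates : ∀ {A : Set} → List A → (A → Set) → Set
Enumerates {A} L S = Unique L × (∀ x → (x ∈ L) ⇔ S x)

module Submission where

-- A matrix P ∈ H_n has a single entry ±1 in each column j, in some row τ j. Since bar swaps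
-- 0 and -1 and fixes 1, coordinate j of a row of bar(bar(M) P) is coordinate τ j of the same
-- row of M, complemented when that entry is -1. So H_n acts row by row through signed
-- permutations of the coordinates; these permute {0,1}^n and preserve Hamming distance, hence
-- preserve 𝒞(G_n). The action on 𝒞(G_n) is free, because every vector of {0,1}^n is a row of M
-- and the images of 0…0 and of the unit vectors determine the signs and τ. Hence every orbit has
-- |H_n| elements, and |H_n| = 2^n n! by choosing the nonzero entry of the first row (n columns,
-- 2 signs) and recursing on the remaining rows. Representatives picked greedily from an
-- enumeration of 𝒞(G_n) then split it into orbits of equal size.

open import Defs
open import Data.Nat using (ℕ; zero; suc; _*_; _^_; _!; _≤_)
import Data.Nat as Nat
open import Data.Nat.Solver using (module +-*-Solver)
open import Data.Product using (Σ; _×_; _,_; proj₁; proj₂)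
open import Data.Sum using (_⊎_; inj₁; inj₂)
open import Data.Empty using (⊥-elim)
open import Data.Bool using (if_then_else_)
open import Data.Integer using (ℤ; 0ℤ; 1ℤ; -1ℤ)
import Data.Integer as ℤ
import Data.Integer.Properties as ℤ
open import Data.Sign using (Sign; +; -)
import Data.Sign as Sign
open import Data.Sign.Properties using (s*s≡+)
open import Data.Fin using (Fin; zero; suc; toℕ; punchIn; punchOut)
open import Data.Fin.Properties using (_≟_; suc-injective; punchIn-injective; punchInᵢ≢i; punchIn-punchOut)
open import Data.Fin.Permutation using (Permutation′; _⟨$⟩ʳ_; _⟨$⟩ˡ_; inverseˡ; inverseʳ; permutation; _∘ₚ_)
import Data.Fin.Permutation as Perm
open import Data.Vec using (Vec; lookup; tabulate; replicate; _∷_; []; insertAt; removeAt)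
import Data.Vec as Vec
import Data.Vec.Properties as Vec
open import Data.List using (List; []; _∷_; length; map; concat; allFin; cartesianProduct)
import Data.List.Properties as List
open import Data.List.Relation.Unary.All as All using (All; []; _∷_)
import Data.List.Relation.Unary.All.Properties as All
open import Data.List.Relation.Unary.Any as Any using (Any; here; there; any?)
open import Data.List.Relation.Unary.AllPairs as AllPairs using (AllPairs; []; _∷_)
import Data.List.Relation.Unary.AllPairs.Properties as AllPairs
open import Data.List.Relation.Unary.Unique.Propositional using (Unique)
import Data.List.Relation.Unary.Unique.Propositional.Properties as Unique
open import Data.List.Relation.Binary.Disjoint.Propositional using (Disjoint)
open import Data.List.Relation.Binary.BagAndSetEquality using (∼bag⇒↭)
open import Data.List.Relation.Binary.Permutation.Propositional.Properties using (↭-length)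
open import Data.List.Membership.Propositional using (_∈_; find; lose)
import Data.List.Membership.Propositional.Properties as ∈
open import Data.List.Membership.Propositional.Properties.WithK using (unique∧set⇒bag)
open import Function using (_∘_)
open import Function.Bundles using (_⇔_; mk⇔; Equivalence)
import Function.Properties.Equivalence as ⇔
open import Relation.Nullary using (¬_; Dec; yes; no; does)
open import Relation.Nullary.Decidable using (dec-true; dec-false)
open import Relation.Binary.PropositionalEquality
open ≡-Reasoning

private
  variable
    A B : Set
    S : A → Set
    n : ℕ
    M N K : Matrix (2 ^ n) n

-- Counting with duplicate-free enumerations

Enumerates⇒All : ∀ {L} → Enumerates L S → All S L
Enumerates⇒All (_ , mem) = All.tabulate λ {x} x∈L → Equivalence.to (mem x) x∈L

Enumerates-length : ∀ {L L′} → Enumerates L S → Enumerates L′ S → length L ≡ length L′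
Enumerates-length (uniq , mem) (uniq′ , mem′) =
  ↭-length (∼bag⇒↭ (unique∧set⇒bag uniq uniq′ λ {x} → ⇔.trans (mem x) (⇔.sym (mem′ x))))

map-unique-on : (f : A → B) → (∀ {x y} → S x → S y → f x ≡ f y → x ≡ y) →
                ∀ {xs} → All S xs → Unique xs → Unique (map f xs)
map-unique-on {S = S} f inj = go
  where
  fresh : ∀ {x ys} → S x → All S ys → All (x ≢_) ys → All (f x ≢_) (map f ys)
  fresh sx [] [] = []
  fresh sx (sy ∷ sys) (x≢y ∷ x∉ys) = (λ fx≡fy → x≢y (inj sx sy fx≡fy)) ∷ fresh sx sys x∉ys
  go : ∀ {xs} → All S xs → Unique xs → Unique (map f xs)
  go [] [] = []
  go (sx ∷ sxs) (x∉xs ∷ uniq) = fresh sx sxs x∉xs ∷ go sxs uniq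

AllPairs-withAll : ∀ {R : A → A → Set} {xs} → All S xs → AllPairs R xs →
                   AllPairs (λ x y → S x × S y × R x y) xs
AllPairs-withAll [] [] = []
AllPairs-withAll {S = S} {R = R} (sx ∷ sxs) (rs ∷ pairs) = pair sx sxs rs ∷ AllPairs-withAll sxs pairs
  where
  pair : ∀ {x ys} → S x → All S ys → All (R x) ys → All (λ y → S x × S y × R x y) ys
  pair sx [] [] = []
  pair sx (sy ∷ sys) (r ∷ rs) = (sx , sy , r) ∷ pair sx sys rs

length-concat-map-const : (f : A → List B) (k : ℕ) → (∀ x → length (f x) ≡ k) →
                          ∀ xs → length (concat (map f xs)) ≡ length xs * k
length-concat-map-const f k len [] = refl
length-concat-map-const f k len (x ∷ xs) =
  trans (List.length-++ (f x)) (cong₂ Nat._+_ (len x) (length-concat-map-const f k len xs))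

length-cartesianProduct : (xs : List A) (ys : List B) →
                          length (cartesianProduct xs ys) ≡ length xs * length ys
length-cartesianProduct [] ys = refl
length-cartesianProduct (x ∷ xs) ys =
  trans (List.length-++ (map (x ,_) ys))
        (cong₂ Nat._+_ (List.length-map (x ,_) ys) (length-cartesianProduct xs ys))

module UniformPartition
  (_∼_ : A → A → Set) (_∼?_ : ∀ x y → Dec (x ∼ y))
  (∼-refl : ∀ {x} → S x → x ∼ x)
  (∼-sym : ∀ {x y} → S x → x ∼ y → y ∼ x)
  (∼-trans : ∀ {x y z} → S x → x ∼ y → y ∼ z → x ∼ z)
  (∼-closed : ∀ {x y} → S x → x ∼ y → S y)
  where

  representatives : List A → List A
  representatives [] = []
  representatives (x ∷ xs) with any? (_∼? x) (representatives xs)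
  ... | yes _ = representatives xs
  ... | no _ = x ∷ representatives xs

  representatives-All : ∀ {xs} → All S xs → All S (representatives xs)
  representatives-All [] = []
  representatives-All {x ∷ xs} (sx ∷ sxs) with any? (_∼? x) (representatives xs)
  ... | yes _ = representatives-All sxs
  ... | no _ = sx ∷ representatives-All sxs

  representatives-unrelated : ∀ {xs} → All S xs → AllPairs (λ r s → ¬ r ∼ s) (representatives xs)
  representatives-unrelated [] = []
  representatives-unrelated {x ∷ xs} (sx ∷ sxs) with any? (_∼? x) (representatives xs)
  ... | yes _ = representatives-unrelated sxs
  ... | no x≁reps = All.¬Any⇒All¬ _ (λ any → x≁reps (Any.map (∼-sym sx) any)) ∷ representatives-unrelated sxs

  representatives-cover : ∀ {xs y} → All S xs → y ∈ xs → Any (_∼ y) (representatives xs)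
  representatives-cover {x ∷ xs} (sx ∷ sxs) y∈ with any? (_∼? x) (representatives xs) | y∈
  ... | yes related | here refl = related
  ... | yes _ | there y∈xs = representatives-cover sxs y∈xs
  ... | no _ | here refl = here (∼-refl sx)
  ... | no _ | there y∈xs = there (representatives-cover sxs y∈xs)

  uniform-partition :
    (class : A → List A) → (∀ x → S x → Enumerates (class x) (x ∼_)) →
    (k : ℕ) → (∀ x → length (class x) ≡ k) →
    ∀ {CL} → Enumerates CL S →
    Σ (List A) λ R → All S R × (∀ x → S x → Any (_∼ x) R) × AllPairs (λ r s → ¬ r ∼ s) R ×
                     (length R * k ≡ length CL)
  uniform-partition class enum k len {CL} enumCL =
    R , reps-S , cover , unrelated , counted
    where
    all-S : All S CL
    all-S = Enumerates⇒All enumCL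
    R : List A
    R = representatives CL
    reps-S : All S R
    reps-S = representatives-All all-S
    unrelated : AllPairs (λ r s → ¬ r ∼ s) R
    unrelated = representatives-unrelated all-S
    cover : ∀ x → S x → Any (_∼ x) R
    cover x sx = representatives-cover all-S (Equivalence.from (proj₂ enumCL x) sx)

    disjoint : ∀ {r s} → S r × S s × ¬ r ∼ s → Disjoint (class r) (class s)
    disjoint (sr , ss , r≁s) (v∈r , v∈s) =
      r≁s (∼-trans sr (Equivalence.to (proj₂ (enum _ sr) _) v∈r)
                      (∼-sym ss (Equivalence.to (proj₂ (enum _ ss) _) v∈s)))

    covered : List A
    covered = concat (map class R)

    covered-unique : Unique covered
    covered-unique = Unique.concat⁺ (All.map⁺ (All.map (λ sr → proj₁ (enum _ sr)) reps-S))
      (AllPairs.map⁺ (AllPairs.map disjoint (AllPairs-withAll reps-S unrelated)))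

    covered-mem : ∀ x → x ∈ covered ⇔ S x
    covered-mem x = mk⇔ to from
      where
      to : x ∈ covered → S x
      to x∈ with ∈.∈-concat⁻′ (map class R) x∈
      ... | _ , x∈c , c∈ with ∈.∈-map⁻ class c∈
      ...   | r , r∈R , refl = ∼-closed (All.lookup reps-S r∈R)
                                 (Equivalence.to (proj₂ (enum r (All.lookup reps-S r∈R)) x) x∈c)
      from : S x → x ∈ covered
      from sx with find (cover x sx)
      ... | r , r∈R , r∼x = ∈.∈-concat⁺′ (Equivalence.from (proj₂ (enum r (All.lookup reps-S r∈R)) x) r∼x)
                                         (∈.∈-map⁺ class r∈R)

    counted : length R * k ≡ length CL
    counted = trans (sym (length-concat-map-const class k len R))
                    (Enumerates-length (covered-unique , covered-mem) enumCL)

-- Signed permutations of {0,1}^n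

lookup-extensionality : ∀ {A : Set} {u v : Vec A n} → (∀ i → lookup u i ≡ lookup v i) → u ≡ v
lookup-extensionality {u = u} {v} eq =
  trans (sym (Vec.tabulate∘lookup u)) (trans (Vec.tabulate-cong eq) (Vec.tabulate∘lookup v))

signℤ : Sign → ℤ
signℤ + = 1ℤ
signℤ - = -1ℤ

signℤ≢0 : ∀ s → signℤ s ≢ 0ℤ
signℤ≢0 + ()
signℤ≢0 - ()

IsSignOrZero : ℤ → Set
IsSignOrZero x = (x ≡ 0ℤ) ⊎ (x ≡ 1ℤ) ⊎ (x ≡ -1ℤ)

signℤ-surjective : ∀ {x} → IsSignOrZero x → x ≢ 0ℤ → Σ Sign λ s → signℤ s ≡ x
signℤ-surjective (inj₁ x≡0) x≢0 = ⊥-elim (x≢0 x≡0)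
signℤ-surjective (inj₂ (inj₁ refl)) _ = + , refl
signℤ-surjective (inj₂ (inj₂ refl)) _ = - , refl

signℤ-injective : ∀ {s t} → signℤ s ≡ signℤ t → s ≡ t
signℤ-injective { + } { + } _ = refl
signℤ-injective { - } { - } _ = refl

-- On a bit, twist + is the identity and twist - is complementation x ↦ 1 - x.
twist : Sign → ℤ → ℤ
twist s x = bar (bar x ℤ.* signℤ s)

twist-bit : ∀ s {x} → IsBit x → IsBit (twist s x)
twist-bit + (inj₁ refl) = inj₁ refl
twist-bit + (inj₂ refl) = inj₂ refl
twist-bit - (inj₁ refl) = inj₂ refl
twist-bit - (inj₂ refl) = inj₁ refl

twist-identity : ∀ {x} → IsBit x → twist + x ≡ x
twist-identity (inj₁ refl) = refl
twist-identity (inj₂ refl) = refl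

twist-* : ∀ s t {x} → IsBit x → twist s (twist t x) ≡ twist (t Sign.* s) x
twist-* + + (inj₁ refl) = refl
twist-* + + (inj₂ refl) = refl
twist-* + - (inj₁ refl) = refl
twist-* + - (inj₂ refl) = refl
twist-* - + (inj₁ refl) = refl
twist-* - + (inj₂ refl) = refl
twist-* - - (inj₁ refl) = refl
twist-* - - (inj₂ refl) = refl

twist-involutive : ∀ s {x} → IsBit x → twist s (twist s x) ≡ x
twist-involutive s {x} bit = begin
  twist s (twist s x) ≡⟨ twist-* s s bit ⟩
  twist (s Sign.* s) x ≡⟨ cong (λ t → twist t x) (s*s≡+ s) ⟩
  twist + x ≡⟨ twist-identity bit ⟩
  x ∎

twist-injective : ∀ s {x y} → IsBit x → IsBit y → twist s x ≡ twist s y → x ≡ y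
twist-injective s {x} {y} bx by eq =
  trans (sym (twist-involutive s bx)) (trans (cong (twist s) eq) (twist-involutive s by))

twist-0-injective : ∀ {s t} → twist s 0ℤ ≡ twist t 0ℤ → s ≡ t
twist-0-injective { + } { + } _ = refl
twist-0-injective { - } { - } _ = refl

record SignedPerm (n : ℕ) : Set where
  field
    perm : Permutation′ n
    sign : Fin n → Sign

  source : Fin n → Fin n
  source j = perm ⟨$⟩ʳ j

open SignedPerm

infixr 5 _▷_

_▷_ : SignedPerm n → Vec ℤ n → Vec ℤ n
p ▷ v = tabulate λ j → twist (sign p j) (lookup v (source p j))

lookup-▷ : ∀ (p : SignedPerm n) v j → lookup (p ▷ v) j ≡ twist (sign p j) (lookup v (source p j))
lookup-▷ p v j = Vec.lookup∘tabulate _ j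

idˢ : SignedPerm n
idˢ = record { perm = Perm.id ; sign = λ _ → + }

_⁻¹ˢ : SignedPerm n → SignedPerm n
p ⁻¹ˢ = record { perm = Perm.flip (perm p) ; sign = λ i → sign p (perm p ⟨$⟩ˡ i) }

_⨾_ : SignedPerm n → SignedPerm n → SignedPerm n
p ⨾ q = record { perm = perm q ∘ₚ perm p ; sign = λ j → sign p (source q j) Sign.* sign q j }

module _ (p : SignedPerm n) where

  ▷-binary : ∀ {v} → IsBinary v → IsBinary (p ▷ v)
  ▷-binary {v} bin j = subst IsBit (sym (lookup-▷ p v j)) (twist-bit (sign p j) (bin (source p j)))

  ▷-inverseˡ : ∀ {v} → IsBinary v → p ⁻¹ˢ ▷ p ▷ v ≡ v
  ▷-inverseˡ {v} bin = lookup-extensionality pointwise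
    where
    pointwise : ∀ i → lookup (p ⁻¹ˢ ▷ p ▷ v) i ≡ lookup v i
    pointwise i = begin
      lookup (p ⁻¹ˢ ▷ p ▷ v) i                  ≡⟨ lookup-▷ (p ⁻¹ˢ) (p ▷ v) i ⟩
      twist (sign p σi) (lookup (p ▷ v) σi)     ≡⟨ cong (twist (sign p σi)) (lookup-▷ p v σi) ⟩
      twist (sign p σi) (twist (sign p σi) (lookup v (source p σi)))
                                                ≡⟨ twist-involutive (sign p σi) (bin _) ⟩
      lookup v (source p σi)                    ≡⟨ cong (lookup v) (inverseʳ (perm p)) ⟩
      lookup v i                                ∎
      where σi = perm p ⟨$⟩ˡ i

  ▷-inverseʳ : ∀ {v} → IsBinary v → p ▷ p ⁻¹ˢ ▷ v ≡ v
  ▷-inverseʳ {v} bin = lookup-extensionality λ j → begin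
    lookup (p ▷ p ⁻¹ˢ ▷ v) j
      ≡⟨ lookup-▷ p (p ⁻¹ˢ ▷ v) j ⟩
    twist (sign p j) (lookup (p ⁻¹ˢ ▷ v) (source p j))
      ≡⟨ cong (twist (sign p j)) (lookup-▷ (p ⁻¹ˢ) v (source p j)) ⟩
    twist (sign p j) (twist (sign p (perm p ⟨$⟩ˡ source p j)) (lookup v (perm p ⟨$⟩ˡ source p j)))
      ≡⟨ cong (λ k → twist (sign p j) (twist (sign p k) (lookup v k))) (inverseˡ (perm p)) ⟩
    twist (sign p j) (twist (sign p j) (lookup v j))
      ≡⟨ twist-involutive (sign p j) (bin j) ⟩
    lookup v j
      ∎

  ▷-injective : ∀ {u v} → IsBinary u → IsBinary v → p ▷ u ≡ p ▷ v → u ≡ v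
  ▷-injective bu bv eq = trans (sym (▷-inverseˡ bu)) (trans (cong (p ⁻¹ˢ ▷_) eq) (▷-inverseˡ bv))

  ▷-differInExactlyOne : ∀ {u v} → IsBinary u → IsBinary v →
                         DifferInExactlyOne u v → DifferInExactlyOne (p ▷ u) (p ▷ v)
  ▷-differInExactlyOne {u} {v} bu bv (k , uk≢vk , only-k) = perm p ⟨$⟩ˡ k , differs , only
    where
    agree-twisted : ∀ j → lookup u (source p j) ≡ lookup v (source p j) → lookup (p ▷ u) j ≡ lookup (p ▷ v) j
    agree-twisted j eq = trans (lookup-▷ p u j) (trans (cong (twist (sign p j)) eq) (sym (lookup-▷ p v j)))
    differs : lookup (p ▷ u) (perm p ⟨$⟩ˡ k) ≢ lookup (p ▷ v) (perm p ⟨$⟩ˡ k)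
    differs eq = uk≢vk (subst (λ i → lookup u i ≡ lookup v i) (inverseʳ (perm p))
      (twist-injective (sign p _) (bu _) (bv _) (trans (sym (lookup-▷ p u _)) (trans eq (lookup-▷ p v _)))))
    only : ∀ j → lookup (p ▷ u) j ≢ lookup (p ▷ v) j → j ≡ perm p ⟨$⟩ˡ k
    only j ne = trans (sym (inverseˡ (perm p))) (cong (perm p ⟨$⟩ˡ_) (only-k (source p j) (ne ∘ agree-twisted j)))

▷-identity : ∀ {v : Vec ℤ n} → IsBinary v → idˢ ▷ v ≡ v
▷-identity {v = v} bin = lookup-extensionality λ j → trans (lookup-▷ idˢ v j) (twist-identity (bin j))

▷-compose : ∀ (p q : SignedPerm n) {v} → IsBinary v → q ▷ p ▷ v ≡ (p ⨾ q) ▷ v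
▷-compose p q {v} bin = lookup-extensionality λ j → begin
  lookup (q ▷ p ▷ v) j                                   ≡⟨ lookup-▷ q (p ▷ v) j ⟩
  twist (sign q j) (lookup (p ▷ v) (source q j))         ≡⟨ cong (twist (sign q j)) (lookup-▷ p v (source q j)) ⟩
  twist (sign q j) (twist (sign p (source q j)) (lookup v (source p (source q j))))
                                                         ≡⟨ twist-* (sign q j) (sign p (source q j)) (bin _) ⟩
  twist (sign (p ⨾ q) j) (lookup v (source (p ⨾ q) j))   ≡⟨ sym (lookup-▷ (p ⨾ q) v j) ⟩
  lookup ((p ⨾ q) ▷ v) j                                 ∎

infixr 5 _▷ᴹ_

_▷ᴹ_ : ∀ {m} → SignedPerm n → Matrix m n → Matrix m n
p ▷ᴹ M = Vec.map (p ▷_) M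

row-▷ᴹ : ∀ {m} (p : SignedPerm n) (M : Matrix m n) i → row (p ▷ᴹ M) i ≡ p ▷ row M i
row-▷ᴹ p M i = Vec.lookup-map i (p ▷_) M

InC⇒binary-rows : ∀ M → InC n M → ∀ i → IsBinary (row M i)
InC⇒binary-rows M ((bits , _) , _) i = bits i

▷ᴹ-InC : ∀ (p : SignedPerm n) {M} → InC n M → InC n (p ▷ᴹ M)
▷ᴹ-InC {n} p {M} inC@((_ , occurs-once) , gray) = (bits , occurs-once′) , gray′
  where
  binary : ∀ i → IsBinary (row M i)
  binary = InC⇒binary-rows M inC
  bits : ∀ i j → IsBit (entry (p ▷ᴹ M) i j)
  bits i = subst IsBinary (sym (row-▷ᴹ p M i)) (▷-binary p {row M i} (binary i))
  occurs-once′ : ∀ v → IsBinary v → Σ (Fin (2 ^ n)) λ i → (row (p ▷ᴹ M) i ≡ v) × (∀ i′ → row (p ▷ᴹ M) i′ ≡ v → i′ ≡ i)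
  occurs-once′ v bin with occurs-once (p ⁻¹ˢ ▷ v) (▷-binary (p ⁻¹ˢ) {v} bin)
  ... | i , rowᵢ≡ , unique = i , rowᵢ′≡ , unique′
    where
    rowᵢ′≡ : row (p ▷ᴹ M) i ≡ v
    rowᵢ′≡ = trans (row-▷ᴹ p M i) (trans (cong (p ▷_) rowᵢ≡) (▷-inverseʳ p {v} bin))
    unique′ : ∀ i′ → row (p ▷ᴹ M) i′ ≡ v → i′ ≡ i
    unique′ i′ eq = unique i′ (▷-injective p {row M i′} (binary i′) (▷-binary (p ⁻¹ˢ) {v} bin)
      (trans (sym (row-▷ᴹ p M i′)) (trans eq (sym (▷-inverseʳ p {v} bin)))))
  gray′ : ∀ (i j : Fin (2 ^ n)) → toℕ j ≡ suc (toℕ i) → DifferInExactlyOne (row (p ▷ᴹ M) i) (row (p ▷ᴹ M) j)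
  gray′ i j adjacent = subst₂ DifferInExactlyOne (sym (row-▷ᴹ p M i)) (sym (row-▷ᴹ p M j))
    (▷-differInExactlyOne p {row M i} {row M j} (binary i) (binary j) (gray i j adjacent))

module _ {M : Matrix (2 ^ n) n} (inC : InC n M) where

  private
    rows-equal : ∀ (f g : Vec ℤ n → Vec ℤ n) → (∀ {v} → IsBinary v → f v ≡ g v) → Vec.map f M ≡ Vec.map g M
    rows-equal f g eq = lookup-extensionality λ i →
      trans (Vec.lookup-map i _ M) (trans (eq (InC⇒binary-rows M inC i)) (sym (Vec.lookup-map i _ M)))

  ▷ᴹ-identity : idˢ ▷ᴹ M ≡ M
  ▷ᴹ-identity = trans (rows-equal (idˢ ▷_) (λ v → v) (λ {v} → ▷-identity {v = v})) (Vec.map-id M)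

  ▷ᴹ-inverseˡ : ∀ (p : SignedPerm n) → p ⁻¹ˢ ▷ᴹ p ▷ᴹ M ≡ M
  ▷ᴹ-inverseˡ p = begin
    p ⁻¹ˢ ▷ᴹ p ▷ᴹ M                     ≡⟨ Vec.map-∘ (p ⁻¹ˢ ▷_) (p ▷_) M ⟨
    Vec.map (λ v → p ⁻¹ˢ ▷ p ▷ v) M     ≡⟨ rows-equal _ (λ v → v) (λ {v} → ▷-inverseˡ p {v}) ⟩
    Vec.map (λ v → v) M                 ≡⟨ Vec.map-id M ⟩
    M                                   ∎

  ▷ᴹ-compose : ∀ (p q : SignedPerm n) → q ▷ᴹ p ▷ᴹ M ≡ (p ⨾ q) ▷ᴹ M
  ▷ᴹ-compose p q = begin
    q ▷ᴹ p ▷ᴹ M                     ≡⟨ Vec.map-∘ (q ▷_) (p ▷_) M ⟨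
    Vec.map (λ v → q ▷ p ▷ v) M     ≡⟨ rows-equal _ ((p ⨾ q) ▷_) (λ {v} → ▷-compose p q {v}) ⟩
    (p ⨾ q) ▷ᴹ M                    ∎

-- Monomial matrices act as signed permutations

unitVec : Fin n → ℤ → Vec ℤ n
unitVec j x = tabulate λ c → if does (c ≟ j) then x else 0ℤ

lookup-unitVec-≡ : ∀ (j : Fin n) x → lookup (unitVec j x) j ≡ x
lookup-unitVec-≡ j x =
  trans (Vec.lookup∘tabulate _ j) (cong (if_then x else 0ℤ) (dec-true (j ≟ j) refl))

lookup-unitVec-≢ : ∀ {c j : Fin n} x → c ≢ j → lookup (unitVec j x) c ≡ 0ℤ
lookup-unitVec-≢ {c = c} {j} x c≢j =
  trans (Vec.lookup∘tabulate _ c) (cong (if_then x else 0ℤ) (dec-false (c ≟ j) c≢j))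

lookup-unitVec-≢0 : ∀ {c j : Fin n} x → lookup (unitVec j x) c ≢ 0ℤ → c ≡ j
lookup-unitVec-≢0 {c = c} {j} x nonzero with c ≟ j
... | yes c≡j = c≡j
... | no c≢j = ⊥-elim (nonzero (lookup-unitVec-≢ x c≢j))

unitVec-unique : ∀ {v : Vec ℤ n} j → (∀ c → lookup v c ≢ 0ℤ → c ≡ j) → v ≡ unitVec j (lookup v j)
unitVec-unique {v = v} j only-j = lookup-extensionality pointwise
  where
  pointwise : ∀ c → lookup v c ≡ lookup (unitVec j (lookup v j)) c
  pointwise c with c ≟ j
  ... | yes refl = sym (lookup-unitVec-≡ c _)
  ... | no c≢j with lookup v c ℤ.≟ 0ℤ
  ...   | yes zero-entry = trans zero-entry (sym (lookup-unitVec-≢ _ c≢j))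
  ...   | no nonzero = ⊥-elim (c≢j (only-j c nonzero))

entry-barM : ∀ {m k} (M : Matrix m k) i j → entry (barM M) i j ≡ bar (entry M i j)
entry-barM M i j =
  trans (cong (λ r → lookup r j) (Vec.lookup-map i (Vec.map bar) M)) (Vec.lookup-map j bar (lookup M i))

entry-⊗ : ∀ {m k l} (A : Matrix m k) (B : Matrix k l) i j →
          entry (A ⊗ B) i j ≡ sumℤ (tabulate λ c → entry A i c ℤ.* entry B c j)
entry-⊗ A B i j = trans (cong (λ r → lookup r j) (Vec.lookup∘tabulate _ i)) (Vec.lookup∘tabulate _ j)

sumℤ-tabulate-zero : ∀ {k} (f : Fin k → ℤ) → (∀ c → f c ≡ 0ℤ) → sumℤ (tabulate f) ≡ 0ℤ
sumℤ-tabulate-zero {zero} f _ = refl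
sumℤ-tabulate-zero {suc k} f zero-everywhere =
  cong₂ ℤ._+_ (zero-everywhere zero) (sumℤ-tabulate-zero (f ∘ suc) (zero-everywhere ∘ suc))

sumℤ-tabulate-single : ∀ {k} (f : Fin k → ℤ) a → (∀ c → c ≢ a → f c ≡ 0ℤ) → sumℤ (tabulate f) ≡ f a
sumℤ-tabulate-single f zero vanish =
  trans (cong (λ s → f zero ℤ.+ s) (sumℤ-tabulate-zero (f ∘ suc) λ c → vanish (suc c) λ ()))
        (ℤ.+-identityʳ (f zero))
sumℤ-tabulate-single f (suc a) vanish =
  trans (cong₂ ℤ._+_ (vanish zero λ ())
                     (sumℤ-tabulate-single (f ∘ suc) a λ c c≢a → vanish (suc c) (c≢a ∘ suc-injective)))
        (ℤ.+-identityˡ _)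

entry-act-column : ∀ (P : Matrix n n) (M : Matrix (2 ^ n) n) i j a → (∀ c → c ≢ a → entry P c j ≡ 0ℤ) →
                   entry (act P M) i j ≡ bar (bar (entry M i a) ℤ.* entry P a j)
entry-act-column P M i j a off-a = begin
  entry (act P M) i j                                         ≡⟨ entry-barM (barM M ⊗ P) i j ⟩
  bar (entry (barM M ⊗ P) i j)                                ≡⟨ cong bar (entry-⊗ (barM M) P i j) ⟩
  bar (sumℤ (tabulate λ c → entry (barM M) i c ℤ.* entry P c j)) ≡⟨ cong bar (sumℤ-tabulate-single _ a vanish) ⟩
  bar (entry (barM M) i a ℤ.* entry P a j)                    ≡⟨ cong (λ x → bar (x ℤ.* entry P a j)) (entry-barM M i a) ⟩
  bar (bar (entry M i a) ℤ.* entry P a j)                     ∎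
  where
  vanish : ∀ c → c ≢ a → entry (barM M) i c ℤ.* entry P c j ≡ 0ℤ
  vanish c c≢a = trans (cong (entry (barM M) i c ℤ.*_) (off-a c c≢a)) (ℤ.*-zeroʳ (entry (barM M) i c))

IsMatrixOf : Matrix n n → SignedPerm n → Set
IsMatrixOf P p = ∀ a j → entry P a j ≡ lookup (unitVec (source p j) (signℤ (sign p j))) a

act-IsMatrixOf : ∀ {P} {p : SignedPerm n} → IsMatrixOf P p → ∀ M → act P M ≡ p ▷ᴹ M
act-IsMatrixOf {P = P} {p} P≅p M = lookup-extensionality λ i → lookup-extensionality λ j → begin
  entry (act P M) i j                                 ≡⟨ entry-act-column P M i j (source p j) (off-source j) ⟩
  bar (bar (entry M i (source p j)) ℤ.* entry P (source p j) j)
       ≡⟨ cong (λ x → bar (bar (entry M i (source p j)) ℤ.* x)) (trans (P≅p _ j) (lookup-unitVec-≡ (source p j) _)) ⟩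
  twist (sign p j) (entry M i (source p j))           ≡⟨ sym (lookup-▷ p (row M i) j) ⟩
  lookup (p ▷ row M i) j                              ≡⟨ cong (λ r → lookup r j) (sym (row-▷ᴹ p M i)) ⟩
  entry (p ▷ᴹ M) i j                                  ∎
  where
  off-source : ∀ j c → c ≢ source p j → entry P c j ≡ 0ℤ
  off-source j c c≢ = trans (P≅p c j) (lookup-unitVec-≢ _ c≢)

lookup-unitVec-signℤ : ∀ (j c : Fin n) s → IsSignOrZero (lookup (unitVec j (signℤ s)) c)
lookup-unitVec-signℤ j c s with c ≟ j
... | no c≢j = inj₁ (lookup-unitVec-≢ _ c≢j)
... | yes refl with s
...   | + = inj₂ (inj₁ (lookup-unitVec-≡ c _))
...   | - = inj₂ (inj₂ (lookup-unitVec-≡ c _))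

IsMatrixOf⇒InH : ∀ {P} {p : SignedPerm n} → IsMatrixOf P p → InH n P
IsMatrixOf⇒InH {n} {P} {p} P≅p = entries , rows , columns
  where
  π : Permutation′ n
  π = perm p
  nonzero : ∀ j → entry P (source p j) j ≢ 0ℤ
  nonzero j = signℤ≢0 (sign p j) ∘ trans (sym (trans (P≅p _ j) (lookup-unitVec-≡ (source p j) _)))
  only-source : ∀ a j → entry P a j ≢ 0ℤ → a ≡ source p j
  only-source a j = lookup-unitVec-≢0 _ ∘ subst (_≢ 0ℤ) (P≅p a j)
  entries : ∀ a j → IsSignOrZero (entry P a j)
  entries a j = subst IsSignOrZero (sym (P≅p a j)) (lookup-unitVec-signℤ _ a (sign p j))
  rows : ∀ a → Σ (Fin n) λ j → (entry P a j ≢ 0ℤ) × (∀ j′ → entry P a j′ ≢ 0ℤ → j′ ≡ j)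
  rows a = π ⟨$⟩ˡ a , subst (λ b → entry P b (π ⟨$⟩ˡ a) ≢ 0ℤ) (inverseʳ π) (nonzero (π ⟨$⟩ˡ a)) ,
           λ j′ nz → trans (sym (inverseˡ π)) (cong (π ⟨$⟩ˡ_) (sym (only-source a j′ nz)))
  columns : ∀ j → Σ (Fin n) λ a → (entry P a j ≢ 0ℤ) × (∀ a′ → entry P a′ j ≢ 0ℤ → a′ ≡ a)
  columns j = source p j , nonzero j , λ a′ → only-source a′ j

monomial : SignedPerm n → Matrix n n
monomial p = tabulate λ a → tabulate λ j → lookup (unitVec (source p j) (signℤ (sign p j))) a

monomial-IsMatrixOf : ∀ (p : SignedPerm n) → IsMatrixOf (monomial p) p
monomial-IsMatrixOf p a j = trans (cong (λ r → lookup r j) (Vec.lookup∘tabulate _ a)) (Vec.lookup∘tabulate _ j)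

module _ (P : Matrix n n) (h : InH n P) where
  private
    entries : ∀ a j → IsSignOrZero (entry P a j)
    entries = proj₁ h
    rows : ∀ a → Σ (Fin n) λ j → (entry P a j ≢ 0ℤ) × (∀ j′ → entry P a j′ ≢ 0ℤ → j′ ≡ j)
    rows = proj₁ (proj₂ h)
    columns : ∀ j → Σ (Fin n) λ a → (entry P a j ≢ 0ℤ) × (∀ a′ → entry P a′ j ≢ 0ℤ → a′ ≡ a)
    columns = proj₂ (proj₂ h)

    column-support : Fin n → Fin n
    column-support j = proj₁ (columns j)

    row-support : Fin n → Fin n
    row-support a = proj₁ (rows a)

    column-sign : ∀ j → Σ Sign λ s → signℤ s ≡ entry P (column-support j) j
    column-sign j = signℤ-surjective (entries _ j) (proj₁ (proj₂ (columns j)))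

  signedPermOf : SignedPerm n
  signedPermOf = record
    { perm = permutation column-support row-support
               (λ a → sym (proj₂ (proj₂ (columns (row-support a))) a (proj₁ (proj₂ (rows a)))))
               (λ j → sym (proj₂ (proj₂ (rows (column-support j))) j (proj₁ (proj₂ (columns j)))))
    ; sign = λ j → proj₁ (column-sign j) }

  InH⇒IsMatrixOf : IsMatrixOf P signedPermOf
  InH⇒IsMatrixOf a j with a ≟ column-support j
  ... | yes refl = trans (sym (proj₂ (column-sign j))) (sym (lookup-unitVec-≡ a _))
  ... | no a≢support with entry P a j ℤ.≟ 0ℤ
  ...   | yes zero-entry = trans zero-entry (sym (lookup-unitVec-≢ _ a≢support))
  ...   | no nonzero = ⊥-elim (a≢support (proj₂ (proj₂ (columns j)) a nonzero))

IsMatrixOf-unique : ∀ {P Q} {p q : SignedPerm n} → IsMatrixOf P p → IsMatrixOf Q q →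
                    (∀ j → source p j ≡ source q j) → (∀ j → sign p j ≡ sign q j) → P ≡ Q
IsMatrixOf-unique {P = P} {Q} {p} {q} P≅p Q≅q same-source same-sign =
  lookup-extensionality λ a → lookup-extensionality λ j →
    trans (P≅p a j) (trans (cong₂ (λ c s → lookup (unitVec c (signℤ s)) a) (same-source j) (same-sign j))
                           (sym (Q≅q a j)))

unitVec-1-binary : ∀ (j : Fin n) → IsBinary (unitVec j 1ℤ)
unitVec-1-binary j c with c ≟ j
... | yes refl = inj₂ (lookup-unitVec-≡ c 1ℤ)
... | no c≢j = inj₁ (lookup-unitVec-≢ 1ℤ c≢j)

zeros-binary : IsBinary (replicate n 0ℤ)
zeros-binary c = inj₁ (Vec.lookup-replicate c 0ℤ)

-- The all-zero vector recovers the signs, and the unit vectors then recover the permutation.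
▷-faithful : ∀ (p q : SignedPerm n) → (∀ v → IsBinary v → p ▷ v ≡ q ▷ v) →
             (∀ j → source p j ≡ source q j) × (∀ j → sign p j ≡ sign q j)
▷-faithful {n} p q agree = same-source , same-sign
  where
  agree-at : ∀ v → IsBinary v → ∀ j →
             twist (sign p j) (lookup v (source p j)) ≡ twist (sign q j) (lookup v (source q j))
  agree-at v bin j = trans (sym (lookup-▷ p v j)) (trans (cong (λ w → lookup w j) (agree v bin)) (lookup-▷ q v j))
  zeros : Vec ℤ n
  zeros = replicate n 0ℤ
  same-sign : ∀ j → sign p j ≡ sign q j
  same-sign j = twist-0-injective (begin
    twist (sign p j) 0ℤ                             ≡⟨ cong (twist (sign p j)) (Vec.lookup-replicate (source p j) 0ℤ) ⟨
    twist (sign p j) (lookup zeros (source p j))    ≡⟨ agree-at zeros zeros-binary j ⟩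
    twist (sign q j) (lookup zeros (source q j))    ≡⟨ cong (twist (sign q j)) (Vec.lookup-replicate (source q j) 0ℤ) ⟩
    twist (sign q j) 0ℤ                             ∎)
  same-source : ∀ j → source p j ≡ source q j
  same-source j = sym (lookup-unitVec-≢0 1ℤ λ e → 1≢0 (trans one-at-source e))
    where
    e : Vec ℤ n
    e = unitVec (source p j) 1ℤ
    1≢0 : 1ℤ ≢ 0ℤ
    1≢0 ()
    one-at-source : 1ℤ ≡ lookup e (source q j)
    one-at-source = twist-injective (sign p j) (inj₂ refl) (unitVec-1-binary _ (source q j)) (begin
      twist (sign p j) 1ℤ                          ≡⟨ cong (twist (sign p j)) (sym (lookup-unitVec-≡ (source p j) 1ℤ)) ⟩
      twist (sign p j) (lookup e (source p j))     ≡⟨ agree-at e (unitVec-1-binary _) j ⟩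
      twist (sign q j) (lookup e (source q j))     ≡⟨ cong (λ s → twist s (lookup e (source q j))) (sym (same-sign j)) ⟩
      twist (sign p j) (lookup e (source q j))     ∎)

-- Every binary vector is a row of a matrix in 𝒞(G_n), so the action on 𝒞(G_n) is free.
act-free : ∀ {P Q M} → InH n P → InH n Q → InC n M → act P M ≡ act Q M → P ≡ Q
act-free {n} {P} {Q} {M} hP hQ inC same-action =
  IsMatrixOf-unique {p = p} {q} (InH⇒IsMatrixOf P hP) (InH⇒IsMatrixOf Q hQ) same-source same-sign
  where
  p q : SignedPerm n
  p = signedPermOf P hP
  q = signedPermOf Q hQ
  same-rows : p ▷ᴹ M ≡ q ▷ᴹ M
  same-rows = trans (sym (act-IsMatrixOf {P = P} {p} (InH⇒IsMatrixOf P hP) M))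
                    (trans same-action (act-IsMatrixOf {P = Q} {q} (InH⇒IsMatrixOf Q hQ) M))
  agree : ∀ v → IsBinary v → p ▷ v ≡ q ▷ v
  agree v bin with proj₂ (proj₁ inC) v bin
  ... | i , refl , _ = trans (sym (row-▷ᴹ p M i)) (trans (cong (λ N → row N i) same-rows) (row-▷ᴹ q M i))
  same-source : ∀ j → source p j ≡ source q j
  same-source = proj₁ (▷-faithful p q agree)
  same-sign : ∀ j → sign p j ≡ sign q j
  same-sign = proj₂ (▷-faithful p q agree)

-- The order of H_n

punchIn-view : ∀ (j c : Fin (suc n)) → c ≡ j ⊎ Σ (Fin n) λ c′ → punchIn j c′ ≡ c
punchIn-view j c with c ≟ j
... | yes c≡j = inj₁ c≡j
... | no c≢j = inj₂ (punchOut (c≢j ∘ sym) , punchIn-punchOut (c≢j ∘ sym))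

extend : Fin (suc n) → Sign → Matrix n n → Matrix (suc n) (suc n)
extend j s Q = unitVec j (signℤ s) ∷ Vec.map (λ r → insertAt r j 0ℤ) Q

module _ (j : Fin (suc n)) (s : Sign) (Q : Matrix n n) where
  private
    E : Matrix (suc n) (suc n)
    E = extend j s Q

  entry-extend-top-column : entry E zero j ≡ signℤ s
  entry-extend-top-column = lookup-unitVec-≡ j (signℤ s)

  entry-extend-top-punchIn : ∀ c → entry E zero (punchIn j c) ≡ 0ℤ
  entry-extend-top-punchIn c = lookup-unitVec-≢ _ (punchInᵢ≢i j c)

  row-extend-suc : ∀ a → row E (suc a) ≡ insertAt (row Q a) j 0ℤ
  row-extend-suc a = Vec.lookup-map a (λ r → insertAt r j 0ℤ) Q

  entry-extend-column : ∀ a → entry E (suc a) j ≡ 0ℤ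
  entry-extend-column a = trans (cong (λ r → lookup r j) (row-extend-suc a)) (Vec.insertAt-lookup (row Q a) j 0ℤ)

  entry-extend-punchIn : ∀ a c → entry E (suc a) (punchIn j c) ≡ entry Q a c
  entry-extend-punchIn a c =
    trans (cong (λ r → lookup r (punchIn j c)) (row-extend-suc a)) (Vec.insertAt-punchIn (row Q a) j 0ℤ c)

  extend-InH⁻ : InH (suc n) E → InH n Q
  extend-InH⁻ (entries , rows , columns) = entries′ , rows′ , columns′
    where
    entries′ : ∀ a c → IsSignOrZero (entry Q a c)
    entries′ a c = subst IsSignOrZero (entry-extend-punchIn a c) (entries (suc a) (punchIn j c))
    rows′ : ∀ a → Σ (Fin n) λ c → (entry Q a c ≢ 0ℤ) × (∀ c′ → entry Q a c′ ≢ 0ℤ → c′ ≡ c)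
    rows′ a with rows (suc a)
    ... | c₀ , nonzero , unique with punchIn-view j c₀
    ...   | inj₁ refl = ⊥-elim (nonzero (entry-extend-column a))
    ...   | inj₂ (c , refl) = c , nonzero ∘ trans (entry-extend-punchIn a c) ,
            λ c′ nz → punchIn-injective j c′ c (unique (punchIn j c′) (nz ∘ trans (sym (entry-extend-punchIn a c′))))
    columns′ : ∀ c → Σ (Fin n) λ a → (entry Q a c ≢ 0ℤ) × (∀ a′ → entry Q a′ c ≢ 0ℤ → a′ ≡ a)
    columns′ c with columns (punchIn j c)
    ... | zero , nonzero , _ = ⊥-elim (nonzero (entry-extend-top-punchIn c))
    ... | suc a , nonzero , unique = a , nonzero ∘ trans (entry-extend-punchIn a c) ,
            λ a′ nz → suc-injective (unique (suc a′) (nz ∘ trans (sym (entry-extend-punchIn a′ c))))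

  extend-InH⁺ : InH n Q → InH (suc n) E
  extend-InH⁺ (entries , rows , columns) = entries′ , rows′ , columns′
    where
    top-nonzero : entry E zero j ≢ 0ℤ
    top-nonzero = signℤ≢0 s ∘ trans (sym entry-extend-top-column)
    entries′ : ∀ a c → IsSignOrZero (entry E a c)
    entries′ zero c = lookup-unitVec-signℤ j c s
    entries′ (suc a) c with punchIn-view j c
    ... | inj₁ refl = inj₁ (entry-extend-column a)
    ... | inj₂ (c′ , refl) = subst IsSignOrZero (sym (entry-extend-punchIn a c′)) (entries a c′)
    rows′ : ∀ a → Σ (Fin (suc n)) λ c → (entry E a c ≢ 0ℤ) × (∀ c′ → entry E a c′ ≢ 0ℤ → c′ ≡ c)
    rows′ zero = j , top-nonzero , λ c → lookup-unitVec-≢0 (signℤ s)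
    rows′ (suc a) with rows a
    ... | c₀ , nonzero , unique = punchIn j c₀ , nonzero ∘ trans (sym (entry-extend-punchIn a c₀)) , unique′
      where
      unique′ : ∀ c → entry E (suc a) c ≢ 0ℤ → c ≡ punchIn j c₀
      unique′ c nz with punchIn-view j c
      ... | inj₁ refl = ⊥-elim (nz (entry-extend-column a))
      ... | inj₂ (c′ , refl) = cong (punchIn j) (unique c′ (nz ∘ trans (entry-extend-punchIn a c′)))
    columns′ : ∀ c → Σ (Fin (suc n)) λ a → (entry E a c ≢ 0ℤ) × (∀ a′ → entry E a′ c ≢ 0ℤ → a′ ≡ a)
    columns′ c with punchIn-view j c
    ... | inj₁ refl = zero , top-nonzero , unique′
      where
      unique′ : ∀ a → entry E a j ≢ 0ℤ → a ≡ zero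
      unique′ zero _ = refl
      unique′ (suc a) nz = ⊥-elim (nz (entry-extend-column a))
    ... | inj₂ (c′ , refl) with columns c′
    ...   | a₀ , nonzero , unique = suc a₀ , nonzero ∘ trans (sym (entry-extend-punchIn a₀ c′)) , unique′
      where
      unique′ : ∀ a → entry E a (punchIn j c′) ≢ 0ℤ → a ≡ suc a₀
      unique′ zero nz = ⊥-elim (nz (entry-extend-top-punchIn c′))
      unique′ (suc a) nz = cong suc (unique a (nz ∘ trans (entry-extend-punchIn a c′)))

InH-extend-surjective : ∀ (P : Matrix (suc n) (suc n)) → InH (suc n) P →
                        Σ (Fin (suc n)) λ j → Σ Sign λ s → Σ (Matrix n n) λ Q → P ≡ extend j s Q
InH-extend-surjective {n} P@(top ∷ rest) (entries , rows , columns) = j , s , Q , cong₂ _∷_ top≡ rest≡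
  where
  j : Fin (suc n)
  j = proj₁ (rows zero)
  top-nonzero : lookup top j ≢ 0ℤ
  top-nonzero = proj₁ (proj₂ (rows zero))
  signed : Σ Sign λ s → signℤ s ≡ lookup top j
  signed = signℤ-surjective (entries zero j) top-nonzero
  s : Sign
  s = proj₁ signed
  Q : Matrix n n
  Q = Vec.map (λ r → removeAt r j) rest
  top≡ : top ≡ unitVec j (signℤ s)
  top≡ = trans (unitVec-unique j (proj₂ (proj₂ (rows zero)))) (cong (unitVec j) (sym (proj₂ signed)))
  below-zero : ∀ a → entry P (suc a) j ≡ 0ℤ
  below-zero a with entry P (suc a) j ℤ.≟ 0ℤ
  ... | yes zero-entry = zero-entry
  ... | no nonzero
    with trans (proj₂ (proj₂ (columns j)) (suc a) nonzero) (sym (proj₂ (proj₂ (columns j)) zero top-nonzero))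
  ...   | ()
  rest≡ : rest ≡ Vec.map (λ r → insertAt r j 0ℤ) Q
  rest≡ = lookup-extensionality λ a → sym (begin
    lookup (Vec.map (λ r → insertAt r j 0ℤ) Q) a ≡⟨ Vec.lookup-map a _ Q ⟩
    insertAt (lookup Q a) j 0ℤ                   ≡⟨ cong (λ r → insertAt r j 0ℤ) (Vec.lookup-map a (λ r → removeAt r j) rest) ⟩
    insertAt (removeAt (lookup rest a) j) j 0ℤ   ≡⟨ cong (insertAt (removeAt (lookup rest a) j) j) (sym (below-zero a)) ⟩
    insertAt (removeAt (lookup rest a) j) j (lookup (lookup rest a) j) ≡⟨ Vec.insertAt-removeAt (lookup rest a) j ⟩
    lookup rest a                                ∎)

unitVec-signℤ-injective : ∀ {j j′ : Fin n} {s s′} → unitVec j (signℤ s) ≡ unitVec j′ (signℤ s′) → j ≡ j′ × s ≡ s′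
unitVec-signℤ-injective {j = j} {j′} {s} {s′} eq = j≡j′ , signℤ-injective (begin
  signℤ s                           ≡⟨ sym (lookup-unitVec-≡ j _) ⟩
  lookup (unitVec j (signℤ s)) j    ≡⟨ cong (λ v → lookup v j) eq ⟩
  lookup (unitVec j′ (signℤ s′)) j  ≡⟨ cong (lookup (unitVec j′ (signℤ s′))) j≡j′ ⟩
  lookup (unitVec j′ (signℤ s′)) j′ ≡⟨ lookup-unitVec-≡ j′ _ ⟩
  signℤ s′                          ∎)
  where
  j≡j′ : j ≡ j′
  j≡j′ = lookup-unitVec-≢0 (signℤ s′) λ e →
    signℤ≢0 s (trans (sym (lookup-unitVec-≡ j _)) (trans (cong (λ v → lookup v j) eq) e))

insertAt-rows-injective : ∀ {m} (j : Fin (suc n)) {Q Q′ : Matrix m n} →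
                          Vec.map (λ r → insertAt r j 0ℤ) Q ≡ Vec.map (λ r → insertAt r j 0ℤ) Q′ → Q ≡ Q′
insertAt-rows-injective j {Q} {Q′} eq = lookup-extensionality λ a → begin
  lookup Q a                                                 ≡⟨ sym (Vec.removeAt-insertAt (lookup Q a) j 0ℤ) ⟩
  removeAt (insertAt (lookup Q a) j 0ℤ) j                    ≡⟨ cong (λ r → removeAt r j) (sym (Vec.lookup-map a _ Q)) ⟩
  removeAt (lookup (Vec.map (λ r → insertAt r j 0ℤ) Q) a) j  ≡⟨ cong (λ M → removeAt (lookup M a) j) eq ⟩
  removeAt (lookup (Vec.map (λ r → insertAt r j 0ℤ) Q′) a) j ≡⟨ cong (λ r → removeAt r j) (Vec.lookup-map a _ Q′) ⟩
  removeAt (insertAt (lookup Q′ a) j 0ℤ) j                   ≡⟨ Vec.removeAt-insertAt (lookup Q′ a) j 0ℤ ⟩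
  lookup Q′ a                                                ∎

extend-injective : ∀ {j j′ : Fin (suc n)} {s s′ Q Q′} → extend j s Q ≡ extend j′ s′ Q′ → (j , s , Q) ≡ (j′ , s′ , Q′)
extend-injective {j = j} {j′} {s} {s′} eq
  with refl , refl ← unitVec-signℤ-injective {j = j} {j′} {s} {s′} (Vec.∷-injectiveˡ eq) =
  cong (λ Q → j , _ , Q) (insertAt-rows-injective j (Vec.∷-injectiveʳ eq))

extend′ : Fin (suc n) × Sign × Matrix n n → Matrix (suc n) (suc n)
extend′ (j , s , Q) = extend j s Q

signs : List Sign
signs = - ∷ + ∷ []

∈-signs : ∀ s → s ∈ signs
∈-signs - = here refl
∈-signs + = there (here refl)

monomials : ∀ n → List (Matrix n n)
monomials zero = [] ∷ []
monomials (suc n) = map extend′ (cartesianProduct (allFin (suc n)) (cartesianProduct signs (monomials n)))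

length-monomials : ∀ n → length (monomials n) ≡ 2 ^ n * n !
length-monomials zero = refl
length-monomials (suc n) = begin
  length (monomials (suc n))                  ≡⟨ List.length-map extend′ (cartesianProduct (allFin (suc n)) choices) ⟩
  length (cartesianProduct (allFin (suc n)) choices)
                                              ≡⟨ length-cartesianProduct (allFin (suc n)) choices ⟩
  length (allFin (suc n)) * length choices    ≡⟨ cong₂ _*_ (List.length-tabulate {n = suc n} (λ i → i))
                                                           (length-cartesianProduct signs (monomials n)) ⟩
  suc n * (2 * length (monomials n))          ≡⟨ cong (λ k → suc n * (2 * k)) (length-monomials n) ⟩
  suc n * (2 * (2 ^ n * n !))                 ≡⟨ rearrange (suc n) (2 ^ n) (n !) ⟩
  2 ^ suc n * suc n !                         ∎
  where
  choices : List (Sign × Matrix n n)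
  choices = cartesianProduct signs (monomials n)
  rearrange : ∀ a b c → a * (2 * (b * c)) ≡ 2 * b * (a * c)
  rearrange = solve 3 (λ a b c → a :* (con 2 :* (b :* c)) := con 2 :* b :* (a :* c)) refl
    where open +-*-Solver

monomials-enumerate : ∀ n → Enumerates (monomials n) (InH n)
monomials-enumerate zero = ([] ∷ []) , λ { [] → mk⇔ (λ _ → (λ ()) , (λ ()) , (λ ())) (λ _ → here refl) }
monomials-enumerate (suc n) = unique , λ P → mk⇔ (sound P) (complete P)
  where
  IH : Enumerates (monomials n) (InH n)
  IH = monomials-enumerate n
  unique : Unique (monomials (suc n))
  unique = Unique.map⁺ {f = extend′} (λ {x} {y} → extend-injective {j = proj₁ x} {proj₁ y})
    (Unique.cartesianProduct⁺ (Unique.allFin⁺ (suc n)) (Unique.cartesianProduct⁺ (((λ ()) ∷ []) ∷ [] ∷ []) (proj₁ IH)))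
  sound : ∀ P → P ∈ monomials (suc n) → InH (suc n) P
  sound P P∈ with ∈.∈-map⁻ extend′ P∈
  ... | (j , s , Q) , t∈ , refl with ∈.∈-cartesianProduct⁻ (allFin (suc n)) _ t∈
  ...   | _ , sQ∈ with ∈.∈-cartesianProduct⁻ signs (monomials n) sQ∈
  ...     | _ , Q∈ = extend-InH⁺ j s Q (Equivalence.to (proj₂ IH Q) Q∈)
  complete : ∀ P → InH (suc n) P → P ∈ monomials (suc n)
  complete P h with InH-extend-surjective P h
  ... | j , s , Q , refl = ∈.∈-map⁺ extend′ (∈.∈-cartesianProduct⁺ (∈.∈-allFin j)
          (∈.∈-cartesianProduct⁺ (∈-signs s) (Equivalence.from (proj₂ IH Q) (extend-InH⁻ j s Q h))))

InH-count : ∀ n {HL} → Enumerates HL (InH n) → length HL ≡ 2 ^ n * n !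
InH-count n enum = trans (Enumerates-length enum (monomials-enumerate n)) (length-monomials n)

-- Orbits

InOrbit⇒▷ᴹ : InOrbit n M N → Σ (SignedPerm n) λ p → p ▷ᴹ M ≡ N
InOrbit⇒▷ᴹ {M = M} (P , h , refl) =
  signedPermOf P h , sym (act-IsMatrixOf {P = P} {signedPermOf P h} (InH⇒IsMatrixOf P h) M)

▷ᴹ⇒InOrbit : ∀ (p : SignedPerm n) → p ▷ᴹ M ≡ N → InOrbit n M N
▷ᴹ⇒InOrbit {M = M} p refl =
  monomial p , IsMatrixOf⇒InH {P = monomial p} {p} (monomial-IsMatrixOf p) ,
  act-IsMatrixOf {P = monomial p} {p} (monomial-IsMatrixOf p) M

act-InC : ∀ P M → InH n P → InC n M → InC n (act P M)
act-InC P M h inC =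
  subst (InC _) (sym (act-IsMatrixOf {P = P} {p} (InH⇒IsMatrixOf P h) M)) (▷ᴹ-InC p {M} inC)
  where
  p : SignedPerm _
  p = signedPermOf P h

InOrbit-InC : InC n M → InOrbit n M N → InC n N
InOrbit-InC {M = M} inC (P , h , refl) = act-InC P M h inC

InOrbit-refl : InC n M → InOrbit n M M
InOrbit-refl {M = M} inC = ▷ᴹ⇒InOrbit idˢ (▷ᴹ-identity {M = M} inC)

InOrbit-sym : InC n M → InOrbit n M N → InOrbit n N M
InOrbit-sym {M = M} inC orbit with p , refl ← InOrbit⇒▷ᴹ {M = M} orbit =
  ▷ᴹ⇒InOrbit (p ⁻¹ˢ) (▷ᴹ-inverseˡ {M = M} inC p)

InOrbit-trans : InC n M → InOrbit n M N → InOrbit n N K → InOrbit n M K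
InOrbit-trans {M = M} inC orbit₁ orbit₂
  with p , refl ← InOrbit⇒▷ᴹ {M = M} orbit₁
  with q , refl ← InOrbit⇒▷ᴹ {M = p ▷ᴹ M} orbit₂ =
  ▷ᴹ⇒InOrbit (p ⨾ q) (sym (▷ᴹ-compose {M = M} inC p q))

module _ {HL : List (Matrix n n)} (enumH : Enumerates HL (InH n)) where

  orbit : Matrix (2 ^ n) n → List (Matrix (2 ^ n) n)
  orbit M = map (λ P → act P M) HL

  InOrbit? : ∀ M N → Dec (InOrbit n M N)
  InOrbit? M N with any? (λ P → Vec.≡-dec (Vec.≡-dec ℤ._≟_) (act P M) N) HL
  ... | yes found with P , P∈ , eq ← find found = yes (P , Equivalence.to (proj₂ enumH P) P∈ , eq)
  ... | no none = no λ (P , h , eq) → none (lose (Equivalence.from (proj₂ enumH P) h) eq)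

  orbit-enumerates : ∀ M → InC n M → Enumerates (orbit M) (InOrbit n M)
  orbit-enumerates M inC =
    map-unique-on (λ P → act P M) (λ {P} {Q} hP hQ → act-free {P = P} {Q} {M} hP hQ inC)
                  (Enumerates⇒All enumH) (proj₁ enumH) ,
    λ N → mk⇔ (to N) (from N)
    where
    to : ∀ N → N ∈ orbit M → InOrbit n M N
    to N N∈ with P , P∈ , refl ← ∈.∈-map⁻ (λ P → act P M) {y = N} N∈ = P , Equivalence.to (proj₂ enumH P) P∈ , refl
    from : ∀ N → InOrbit n M N → N ∈ orbit M
    from N (P , h , refl) = ∈.∈-map⁺ (λ P → act P M) (Equivalence.from (proj₂ enumH P) h)

  length-orbit : ∀ M → length (orbit M) ≡ 2 ^ n * n !
  length-orbit M = trans (List.length-map (λ P → act P M) HL) (InH-count n enumH)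

theorem2 : (n : ℕ) → 1 ≤ n →
    (CL : List (Matrix (2 ^ n) n)) → Enumerates CL (InC n) →
    (HL : List (Matrix n n)) → Enumerates HL (InH n) →
    (length HL ≡ 2 ^ n * n !) ×
    (∀ P M → InH n P → InC n M → InC n (act P M)) ×
    (∀ M → InC n M → (OL : List (Matrix (2 ^ n) n)) → Enumerates OL (InOrbit n M) →
       length OL ≡ 2 ^ n * n !) ×
    Σ (List (Matrix (2 ^ n) n)) (λ R →
       All (InC n) R ×
       (∀ M → InC n M → Any (λ r → InOrbit n r M) R) ×
       AllPairs (λ r s → ¬ InOrbit n r s) R ×
       (length R * (2 ^ n * n !) ≡ length CL))
theorem2 n _ CL enumC HL enumH =
  InH-count n enumH ,
  act-InC ,
  (λ M inC OL enumO → trans (Enumerates-length enumO (orbit-enumerates enumH M inC)) (length-orbit enumH M)) ,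
  uniform-partition (orbit enumH) (orbit-enumerates enumH) (2 ^ n * n !) (length-orbit enumH) enumC
  where
  open UniformPartition (InOrbit n) (InOrbit? enumH)
    (λ {M} → InOrbit-refl {M = M}) (λ {M} → InOrbit-sym {M = M})
    (λ {M} → InOrbit-trans {M = M}) (λ {M} → InOrbit-InC {M = M})
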